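{- Let $n\geq 5$ and let $f:E(K_n)\to\{ -1,1\}$ be a weighting such that no copy $H$ of $K_4$ in $K_n$ satisfies $\sum_{e\in E(H)}f(e)=0$. Let $G_{ -1}$ and $G_1$ be the graphs on vertex set $V(K_n)$ with edge sets $f^{ -1}(-1)$ and $f^{ -1}(1)$, respectively. Then at least one of $G_{ -1}$, $G_1$ contains no triangle.
   Context: $K_n$ is the complete graph on $n$ vertices; a copy of $K_4$ in $K_n$ is the complete subgraph on some 4 of its vertices. -}

module Defs where

open import Data.Nat using (ℕ)
open import Data.Fin using (Fin)
open import Data.Integer using (ℤ; _+_; +_; -[1+_])
open import Data.Product using (_×_; ∃-syntax)
open import Relation.Binary.PropositionalEquality using (_≡_; _≢_)

-- A ±1 weighting of the edges of K_n.  Vertices are Fin n; an edge {u,v}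
-- (u ≢ v) gets weight w u v.  Values on the diagonal are irrelevant.
data PM : Set where
  neg pos : PM

val : PM → ℤ
val neg = -[1+ 0 ]
val pos = + 1

Symmetric : {n : ℕ} → (Fin n → Fin n → PM) → Set
Symmetric {n} f = (u v : Fin n) → u ≢ v → f u v ≡ f v u

Distinct4 : {n : ℕ} → Fin n → Fin n → Fin n → Fin n → Set
Distinct4 a b c d =
  a ≢ b × a ≢ c × a ≢ d × b ≢ c × b ≢ d × c ≢ d

K4sum : {n : ℕ} → (Fin n → Fin n → PM) → Fin n → Fin n → Fin n → Fin n → ℤ
K4sum f a b c d =
  val (f a b) + val (f a c) + val (f a d) + val (f b c) + val (f b d) + val (f c d)

HasTriangle : {n : ℕ} → (Fin n → Fin n → PM) → PM → Set
HasTriangle {n} f s = ∃[ x ] ∃[ y ] ∃[ z ]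
  (x ≢ y × x ≢ z × y ≢ z × f x y ≡ s × f x z ≡ s × f y z ≡ s)

module Submission where

-- Call a K_4 balanced if it has three edges of each colour,
-- i.e. weight 0; by hypothesis there is no balanced K_4.  We show that a
-- negative triangle T and a positive triangle P cannot coexist, which gives
-- the theorem by deciding whether a negative triangle exists.
--   1. (no mixed bowtie) T and P cannot share a vertex: for T = xyz and
--      P = xbc, a case analysis on the four edges between {y,z} and {b,c}
--      always exhibits a balanced K_4 among {x,y,z,b,c}.
--   2. Hence no vertex of P lies on T.  Consequently a vertex of P has at most
--      one negative edge into T (two would form a negative triangle through
--      it), and two adjacent vertices of P have no common positive neighbour
--      on T (it would form a positive triangle through a vertex of T).
--   3. Take two vertices a, b of P.  Each is negative to at most one vertex of
--      T, so some vertex of T is positive to both a and b, contradicting 2.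
-- The argument does not use the hypothesis n ≥ 5.

open import Defs
open import Data.Nat using (ℕ; _≥_)
open import Data.Fin using (Fin)
open import Data.Fin.Properties using (any?) renaming (_≟_ to _≟ᶠ_)
open import Data.Integer using (+_; _+_)
open import Data.Sum using (_⊎_; inj₁; inj₂)
open import Data.Product using (_×_; _,_)
open import Data.Empty using (⊥; ⊥-elim)
open import Relation.Nullary using (¬_; Dec; yes; no)
open import Relation.Nullary.Decidable using (_×-dec_; ¬?)
open import Relation.Binary.Definitions using (DecidableEquality)
open import Relation.Binary.PropositionalEquality
  using (_≡_; _≢_; refl; sym; trans; ≢-sym)

neg≢pos : neg ≢ pos
neg≢pos ()

¬neg⇒pos : {p : PM} → p ≢ neg → p ≡ pos
¬neg⇒pos {neg} p≢neg = ⊥-elim (p≢neg refl)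
¬neg⇒pos {pos} _     = refl

_≟ᴾ_ : DecidableEquality PM
neg ≟ᴾ neg = yes refl
neg ≟ᴾ pos = no neg≢pos
pos ≟ᴾ neg = no (λ ())
pos ≟ᴾ pos = yes refl

Triangle : {n : ℕ} → (Fin n → Fin n → PM) → PM → Fin n → Fin n → Fin n → Set
Triangle f s x y z = x ≢ y × x ≢ z × y ≢ z × f x y ≡ s × f x z ≡ s × f y z ≡ s

hasTriangle? : {n : ℕ} (f : Fin n → Fin n → PM) (s : PM) → Dec (HasTriangle f s)
hasTriangle? f s = any? λ x → any? λ y → any? λ z →
  ¬? (x ≟ᶠ y) ×-dec ¬? (x ≟ᶠ z) ×-dec ¬? (y ≟ᶠ z) ×-dec
  (f x y ≟ᴾ s) ×-dec (f x z ≟ᴾ s) ×-dec (f y z ≟ᴾ s)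

module MixedTriangles {n : ℕ} (f : Fin n → Fin n → PM) (symf : Symmetric f)
  (noBalancedK4 : (a b c d : Fin n) → Distinct4 a b c d → K4sum f a b c d ≢ + 0)
  where

  flipEdge : {u v : Fin n} {s : PM} → u ≢ v → f u v ≡ s → f v u ≡ s
  flipEdge u≢v fuv = trans (symf _ _ (≢-sym u≢v)) fuv

  rotate : ∀ {s x y z} → Triangle f s x y z → Triangle f s y z x
  rotate (xy , xz , yz , fxy , fxz , fyz) =
    yz , ≢-sym xy , ≢-sym xz , fyz , flipEdge xy fxy , flipEdge xz fxz

  swap : ∀ {s x y z} → Triangle f s x y z → Triangle f s y x z
  swap (xy , xz , yz , fxy , fxz , fyz) =
    ≢-sym xy , yz , xz , flipEdge xy fxy , fyz , fxz

  endpointsDiffer : {x u v : Fin n} → f x u ≡ neg → f x v ≡ pos → u ≢ v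
  endpointsDiffer fxu fxv refl = neg≢pos (trans (sym fxu) fxv)

  -- A K_4 whose six edge colours (given in the order of K4sum) sum to zero
  -- is balanced, hence excluded; the sum condition is checked by computation.
  balanced : (a b c d : Fin n) → Distinct4 a b c d → ∀ {p₁ p₂ p₃ p₄ p₅ p₆} →
    f a b ≡ p₁ → f a c ≡ p₂ → f a d ≡ p₃ → f b c ≡ p₄ → f b d ≡ p₅ → f c d ≡ p₆ →
    val p₁ + val p₂ + val p₃ + val p₄ + val p₅ + val p₆ ≡ + 0 → ⊥
  balanced a b c d D refl refl refl refl refl refl = noBalancedK4 a b c d D

  -- Step 1: a negative and a positive triangle never share a vertex.  With
  -- T = xyz and P = xbc, every colouring of yb, zb, yc, zc makes one of the
  -- five K_4's on {x,y,z,b,c} balanced.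
  noMixedBowtie : ∀ {x y z b c} → Triangle f neg x y z → Triangle f pos x b c → ⊥
  noMixedBowtie {x} {y} {z} {b} {c}
    (xy , xz , yz , fxy , fxz , fyz) (xb , xc , bc , fxb , fxc , fbc) = byCrossEdges
    where
    yb : y ≢ b
    yb = endpointsDiffer fxy fxb
    zb : z ≢ b
    zb = endpointsDiffer fxz fxb
    yc : y ≢ c
    yc = endpointsDiffer fxy fxc
    zc : z ≢ c
    zc = endpointsDiffer fxz fxc
    xyzb : Distinct4 x y z b
    xyzb = xy , xz , xb , yz , yb , zb
    xyzc : Distinct4 x y z c
    xyzc = xy , xz , xc , yz , yc , zc
    xybc : Distinct4 x y b c
    xybc = xy , xb , xc , yb , yc , bc
    xzbc : Distinct4 x z b c
    xzbc = xz , xb , xc , zb , zc , bc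
    yzbc : Distinct4 y z b c
    yzbc = yz , yb , yc , zb , zc , bc
    byCrossEdges : ⊥
    byCrossEdges with f y b in fyb | f z b in fzb | f y c in fyc | f z c in fzc
    ... | pos | pos | _   | _   = balanced x y z b xyzb fxy fxz fxb fyz fyb fzb refl
    ... | _   | _   | pos | pos = balanced x y z c xyzc fxy fxz fxc fyz fyc fzc refl
    ... | neg | _   | neg | _   = balanced x y b c xybc fxy fxb fxc fyb fyc fbc refl
    ... | _   | neg | _   | neg = balanced x z b c xzbc fxz fxb fxc fzb fzc fbc refl
    ... | neg | pos | pos | neg = balanced y z b c yzbc fyz fyb fyc fzb fzc fbc refl
    ... | pos | neg | neg | pos = balanced y z b c yzbc fyz fyb fyc fzb fzc fbc refl

  Off : Fin n → Fin n → Fin n → Fin n → Set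
  Off a x y z = a ≢ x × a ≢ y × a ≢ z

  offTriangle : ∀ {x y z a b c} →
    Triangle f neg x y z → Triangle f pos a b c → Off a x y z
  offTriangle T P =
      (λ { refl → noMixedBowtie T P })
    , (λ { refl → noMixedBowtie (rotate T) P })
    , (λ { refl → noMixedBowtie (rotate (rotate T)) P })

  -- Step 2b: a vertex a of a positive triangle, negative to one end of a
  -- negative edge uw, is positive to the other end (else auw is a negative
  -- triangle through a).
  fanRule : ∀ {a b c u w} → Triangle f pos a b c → a ≢ u → a ≢ w → u ≢ w →
    f u w ≡ neg → f a u ≡ neg → f a w ≡ pos
  fanRule P au aw uw fuw fau =
    ¬neg⇒pos λ faw → noMixedBowtie (au , aw , uw , fau , faw , fuw) P

  -- Step 2c: the ends of a positive edge ab have no common positive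
  -- neighbour x on a negative triangle (else xab is a positive triangle).
  noCommonPositive : ∀ {x y z a b} → Triangle f neg x y z → a ≢ x → b ≢ x →
    a ≢ b → f a b ≡ pos → f a x ≡ pos → f b x ≡ pos → ⊥
  noCommonPositive T ax bx ab fab fax fbx =
    noMixedBowtie T (≢-sym ax , ≢-sym bx , ab , flipEdge ax fax , flipEdge bx fbx , fab)

  -- Step 3, main case: if the vertex a of P is negative to x, it is positive
  -- to y and z; then b is positive to y or to z, a common positive neighbour.
  negativeToVertex : ∀ {x y z a b c} → Triangle f neg x y z → Triangle f pos a b c →
    Off a x y z → Off b x y z → f a x ≡ neg → ⊥
  negativeToVertex {x} {y} {z} {a} {b}
    T@(xy , xz , yz , fxy , fxz , fyz) P@(ab , _ , _ , fab , _ , _)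
    (ax , ay , az) (bx , by , bz) fax with f b y in fby
  ... | pos = noCommonPositive (rotate T) ay by ab fab fay fby
    where
    fay : f a y ≡ pos
    fay = fanRule P ax ay xy fxy fax
  ... | neg = noCommonPositive (rotate (rotate T)) az bz ab fab faz fbz
    where
    faz : f a z ≡ pos
    faz = fanRule P ax az xz fxz fax
    fbz : f b z ≡ pos
    fbz = fanRule (rotate P) by bz yz fyz fby

  noMixedTriangles : ∀ {x y z a b c} →
    Triangle f neg x y z → Triangle f pos a b c → ⊥
  noMixedTriangles {x} {a = a} {b} T P@(ab , _ , _ , fab , _ , _)
    with offTriangle T P | offTriangle T (rotate P) | f a x in fax | f b x in fbx
  ... | aOff | bOff | neg | _   = negativeToVertex T P aOff bOff fax
  ... | aOff | bOff | pos | neg = negativeToVertex T (swap P) bOff aOff fbx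
  ... | (ax , _) | (bx , _) | pos | pos = noCommonPositive T ax bx ab fab fax fbx

lemma6 : (n : ℕ) → n ≥ 5 → (f : Fin n → Fin n → PM) → Symmetric f
    → ((a b c d : Fin n) → Distinct4 a b c d → K4sum f a b c d ≢ + 0)
    → ¬ HasTriangle f neg ⊎ ¬ HasTriangle f pos
lemma6 n _ f symf noBalancedK4 with hasTriangle? f neg
... | no noNegative = inj₁ noNegative
... | yes (_ , _ , _ , T) =
  inj₂ λ { (_ , _ , _ , P) → MixedTriangles.noMixedTriangles f symf noBalancedK4 T P }
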